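{- Let $\mathcal{C}$ be a class of hypergraphs that is stable under taking projections. If $\mathcal{C}$ has unbounded dual VC dimension, then for every integer $k$ there exists a hypergraph $\mathcal{H}$ in $\mathcal{C}$ with $2^k-1$ vertices and a test cover of size $k$.
   Context: For a finite hypergraph $\mathcal{H}=(V,\mathcal{E})$ and $X\subseteq V$, the projection $\mathcal{H}_{|X}$ is the hypergraph with vertex set $X$ and hyperedges $\{e\cap X: e\in\mathcal{E}\}$. A set $X$ is shattered if $|\mathcal{H}_{|X}|=2^{|X|}$; $vc(\mathcal{H})$ is the maximum size of a shattered set. The dual hypergraph $\mathcal{H}^*$ has the hyperedges of $\mathcal{H}$ as vertices and, for each vertex $v$ of $\mathcal{H}$, a hyperedge consisting of the hyperedges containing $v$; the dual VC dimension is $vc(\mathcal{H}^*)$. A test cover of $\mathcal{H}$ is a set of hyperedges such that every vertex is in one of them and any two distinct vertices are separated by one of them (it contains exactly one of the two). -}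

module Defs where

open import Data.Nat using (ℕ; zero; suc; _≥_)
open import Data.Fin using (Fin)
open import Data.Vec using (Vec; []; _∷_; tabulate)
import Data.Vec
import Data.List
open import Data.List using (List; length; map; lookup)
open import Data.List.Membership.Propositional using () renaming (_∈_ to _∈ₗ_)
open import Data.Fin.Subset using (Subset; Side; inside; outside; _∈_; _∉_; _⊆_; _∩_; ∣_∣)
open import Data.Product using (Σ; ∃; _×_; _,_)
open import Data.Sum using (_⊎_)
open import Relation.Binary.PropositionalEquality using (_≡_; _≢_)
open import Function.Definitions using (Injective)

-- A finite hypergraph: vertex set Fin n, hyperedges given as a list of
-- subsets of the vertex set (the hyperedge SET is the set of list entries).
record Hypergraph : Set where
  constructor hyp
  field
    n     : ℕ
    edges : List (Subset n)
open Hypergraph public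

size : ∀ {n} → Subset n → ℕ
size []             = zero
size (inside  ∷ X)  = suc (size X)
size (outside ∷ X)  = size X

-- e ∩ X, viewed as a subset of X ≅ Fin (size X) (order-preserving relabelling)
restrict : ∀ {n} (X : Subset n) → Subset n → Subset (size X)
restrict []            []       = []
restrict (inside  ∷ X) (b ∷ e)  = b ∷ restrict X e
restrict (outside ∷ X) (b ∷ e)  = restrict X e

project : (H : Hypergraph) → Subset (n H) → Hypergraph
project H X = hyp (size X) (map (restrict X) (edges H))

-- dual hypergraph: vertices are the hyperedges of H (indexed by position in
-- the list), and for each vertex v of H a hyperedge consisting of the
-- hyperedges containing v
dual : Hypergraph → Hypergraph
dual H = hyp (length (edges H))
             (Data.List.tabulate {n = n H}
                (λ v → tabulate (λ i → Data.Vec.lookup (lookup (edges H) i) v)))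

Shattered : (H : Hypergraph) → Subset (n H) → Set
Shattered H X = ∀ (Y : Subset (n H)) → Y ⊆ X →
  ∃ λ e → (e ∈ₗ edges H) × (e ∩ X ≡ Y)

VC≥ : Hypergraph → ℕ → Set
VC≥ H d = ∃ λ (X : Subset (n H)) → Shattered H X × (∣ X ∣ ≥ d)

TestCover : (H : Hypergraph) (k : ℕ) → Set
TestCover H k = Σ (Fin k → Subset (n H)) λ T →
    Injective _≡_ _≡_ T
  × (∀ j → T j ∈ₗ edges H)
  × (∀ v → ∃ λ j → v ∈ T j)
  × (∀ u v → u ≢ v → ∃ λ j → (u ∈ T j × v ∉ T j) ⊎ (v ∈ T j × u ∉ T j))

ProjectionStable : (Hypergraph → Set) → Set
ProjectionStable C = ∀ H → C H → ∀ (X : Subset (n H)) → C (project H X)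

UnboundedDualVC : (Hypergraph → Set) → Set
UnboundedDualVC C = ∀ d → ∃ λ H → C H × VC≥ (dual H) d

module Submission where

-- Call k hyperedges E₀,…,E_{k−1} of H an independent family when every
-- pattern S ⊆ {0,…,k−1} is realised by a vertex v, i.e. {j : v ∈ E_j} = S.
-- A set of k hyperedges shattered in the dual hypergraph is such a family,
-- so unbounded dual VC dimension yields, for each k, some H ∈ C with an
-- independent family of size k.  Given one, choose the realising vertex of
-- every NONEMPTY pattern and project H onto these 2^k − 1 vertices.  There a
-- vertex u is determined by its code {j : u ∈ E_j}, so the traces of
-- E₀,…,E_{k−1} form a test cover: a nonempty code covers u, distinct codes
-- separate two vertices, and the vertex with code {j} tells E_j from E_j'.

open import Defs
open import Data.Bool.Properties using (∧-identityʳ)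
open import Data.Empty using (⊥-elim)
open import Data.Fin using (Fin; zero; suc; _↑ˡ_; combine; funToFin; finToFun)
open import Data.Fin.Properties
  using (2↔Bool; suc-injective; funToFin-finToFin; finToFun-funToFin; cantor-schröder-bernstein)
  renaming (_≟_ to _≟ᶠ_)
open import Data.Fin.Subset
  using (Subset; inside; outside; _∈_; _∉_; _⊆_; _∩_; ∣_∣; ⊥; ⁅_⁆; Nonempty)
open import Data.Fin.Subset.Properties using (∉⊥; x∈⁅x⁆; x∈⁅y⁆⇒x≡y; nonempty?; Empty-unique)
import Data.List as List
open import Data.List.Membership.Propositional.Properties using (∈-map⁺; ∈-lookup; ∈-tabulate⁻)
open import Data.Nat using (ℕ; zero; suc; _+_; _^_; _∸_; _≤_)
open import Data.Nat.Properties using (m≤n⇒∃[o]m+o≡n)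
open import Data.Product using (∃; _×_; _,_; proj₁; proj₂)
open import Data.Sum using (_⊎_; inj₁; inj₂)
import Data.Sum as Sum
open import Data.Vec using (_∷_; []; _++_; replicate; lookup; tabulate; here; there)
open import Data.Vec.Properties
  using (lookup∘tabulate; tabulate∘lookup; tabulate-cong; lookup⇒[]=; []=⇒lookup; lookup-++ˡ)
open import Function using (_∘_)
open import Function.Bundles using (Inverse)
open import Function.Definitions using (Injective)
open import Relation.Nullary using (Dec; yes; no; does)
open import Relation.Nullary.Decidable using (_×-dec_)
open import Relation.Unary using (Decidable)
open import Relation.Binary.PropositionalEquality

retraction⇒injective : ∀ {A B : Set} {s : A → B} (r : B → A) →
  (∀ x → r (s x) ≡ x) → Injective _≡_ _≡_ s
retraction⇒injective {s = s} r r∘s {x} {y} sx≡sy =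
  trans (sym (r∘s x)) (trans (cong r sx≡sy) (r∘s y))

∈-transport : ∀ {m n} {P : Subset m} {Q : Subset n} {i j} →
  lookup P i ≡ lookup Q j → i ∈ P → j ∈ Q
∈-transport {Q = Q} {j = j} Pi≡Qj i∈P =
  lookup⇒[]= j Q (trans (sym Pi≡Qj) ([]=⇒lookup i∈P))

_∈_∖_ : ∀ {k} → Fin k → Subset k → Subset k → Set
j ∈ P ∖ Q = j ∈ P × j ∉ Q

Separated : ∀ {k} → Subset k → Subset k → Set
Separated P Q = ∃ λ j → j ∈ P ∖ Q ⊎ j ∈ Q ∖ P

separated-∷ : ∀ {k b c} {P Q : Subset k} → Separated P Q → Separated (b ∷ P) (c ∷ Q)
separated-∷ (j , s) = suc j , Sum.map lift∖ lift∖ s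
  where
  lift∖ : ∀ {k b c} {P Q : Subset k} {j} → j ∈ P ∖ Q → suc j ∈ (b ∷ P) ∖ (c ∷ Q)
  lift∖ (j∈P , j∉Q) = there j∈P , λ { (there j∈Q) → j∉Q j∈Q }

distinct⇒separated : ∀ {k} (P Q : Subset k) → P ≢ Q → Separated P Q
distinct⇒separated []            []            P≢Q = ⊥-elim (P≢Q refl)
distinct⇒separated (inside ∷ P)  (outside ∷ Q) _   = zero , inj₁ (here , λ ())
distinct⇒separated (outside ∷ P) (inside ∷ Q)  _   = zero , inj₂ (here , λ ())
distinct⇒separated (inside ∷ P)  (inside ∷ Q)  P≢Q =
  separated-∷ (distinct⇒separated P Q (P≢Q ∘ cong (inside ∷_)))
distinct⇒separated (outside ∷ P) (outside ∷ Q) P≢Q =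
  separated-∷ (distinct⇒separated P Q (P≢Q ∘ cong (outside ∷_)))

select : ∀ {n} {P : Fin n → Set} → Decidable P → Subset n
select P? = tabulate (does ∘ P?)

select-sound : ∀ {n} {P : Fin n → Set} (P? : Decidable P) {w} → w ∈ select P? → P w
select-sound P? {w} w∈ = holds (P? w) (trans (sym (lookup∘tabulate (does ∘ P?) w)) ([]=⇒lookup w∈))
  where
  holds : ∀ {A : Set} (A? : Dec A) → does A? ≡ inside → A
  holds (yes a) _ = a

select-complete : ∀ {n} {P : Fin n → Set} (P? : Decidable P) {w} → P w → w ∈ select P?
select-complete P? {w} p with P? w in eq
... | yes _ = lookup⇒[]= w (select P?) (trans (lookup∘tabulate (does ∘ P?) w) (cong does eq))
... | no ¬p = ⊥-elim (¬p p)

size≡∣∣ : ∀ {n} (X : Subset n) → size X ≡ ∣ X ∣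
size≡∣∣ []            = refl
size≡∣∣ (inside ∷ X)  = cong suc (size≡∣∣ X)
size≡∣∣ (outside ∷ X) = size≡∣∣ X

embed : ∀ {n} (X : Subset n) → Fin (size X) → Fin n
embed (inside ∷ X)  zero    = zero
embed (inside ∷ X)  (suc u) = suc (embed X u)
embed (outside ∷ X) u       = suc (embed X u)

embed-∈ : ∀ {n} (X : Subset n) u → embed X u ∈ X
embed-∈ (inside ∷ X)  zero    = here
embed-∈ (inside ∷ X)  (suc u) = there (embed-∈ X u)
embed-∈ (outside ∷ X) u       = there (embed-∈ X u)

embed-injective : ∀ {n} (X : Subset n) → Injective _≡_ _≡_ (embed X)
embed-injective (inside ∷ X)  {zero}  {zero}  _ = refl
embed-injective (inside ∷ X)  {suc u} {suc v} e = cong suc (embed-injective X (suc-injective e))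
embed-injective (outside ∷ X) e                 = embed-injective X (suc-injective e)

unembed : ∀ {n} (X : Subset n) {w} → w ∈ X → Fin (size X)
unembed (inside ∷ X)  here      = zero
unembed (inside ∷ X)  (there p) = suc (unembed X p)
unembed (outside ∷ X) (there p) = unembed X p

embed-unembed : ∀ {n} (X : Subset n) {w} (w∈X : w ∈ X) → embed X (unembed X w∈X) ≡ w
embed-unembed (inside ∷ X)  here      = refl
embed-unembed (inside ∷ X)  (there p) = cong suc (embed-unembed X p)
embed-unembed (outside ∷ X) (there p) = cong suc (embed-unembed X p)

restrict-lookup : ∀ {n} (X e : Subset n) u → lookup (restrict X e) u ≡ lookup e (embed X u)
restrict-lookup (inside ∷ X)  (b ∷ e) zero    = refl
restrict-lookup (inside ∷ X)  (b ∷ e) (suc u) = restrict-lookup X e u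
restrict-lookup (outside ∷ X) (b ∷ e) u       = restrict-lookup X e u

restrict-∩ : ∀ {n} (X e : Subset n) → restrict X (e ∩ X) ≡ restrict X e
restrict-∩ []            []      = refl
restrict-∩ (inside ∷ X)  (b ∷ e) = cong₂ _∷_ (∧-identityʳ b) (restrict-∩ X e)
restrict-∩ (outside ∷ X) (b ∷ e) = restrict-∩ X e

lift : ∀ {n} (X : Subset n) → Subset (size X) → Subset n
lift []            []      = []
lift (inside ∷ X)  (b ∷ S) = b ∷ lift X S
lift (outside ∷ X) S       = outside ∷ lift X S

lift-⊆ : ∀ {n} (X : Subset n) S → lift X S ⊆ X
lift-⊆ (inside ∷ X)  (b ∷ S) here      = here
lift-⊆ (inside ∷ X)  (b ∷ S) (there p) = there (lift-⊆ X S p)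
lift-⊆ (outside ∷ X) S       (there p) = there (lift-⊆ X S p)

restrict-lift : ∀ {n} (X : Subset n) S → restrict X (lift X S) ≡ S
restrict-lift []            []      = refl
restrict-lift (inside ∷ X)  (b ∷ S) = cong (b ∷_) (restrict-lift X S)
restrict-lift (outside ∷ X) S       = restrict-lift X S

∩≡lift⇒restrict≡ : ∀ {n} (X e : Subset n) {S} → e ∩ X ≡ lift X S → restrict X e ≡ S
∩≡lift⇒restrict≡ X e {S} e∩X≡ =
  trans (sym (restrict-∩ X e)) (trans (cong (restrict X) e∩X≡) (restrict-lift X S))

-- Subsets of Fin k are coded by Fin (2 ^ k) via their characteristic
-- functions Fin k → Fin 2.
open Inverse 2↔Bool using (strictlyInverseˡ; strictlyInverseʳ)
  renaming (to to toBool; from to fromBool)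

funToFin-cong : ∀ {m n} {f g : Fin m → Fin n} → f ≗ g → funToFin f ≡ funToFin g
funToFin-cong {zero}  f≗g = refl
funToFin-cong {suc m} f≗g = cong₂ combine (f≗g zero) (funToFin-cong (f≗g ∘ suc))

toCode : ∀ {k} → Subset k → Fin (2 ^ k)
toCode S = funToFin (fromBool ∘ lookup S)

fromCode : ∀ {k} → Fin (2 ^ k) → Subset k
fromCode i = tabulate (toBool ∘ finToFun i)

toCode-fromCode : ∀ k (i : Fin (2 ^ k)) → toCode (fromCode {k} i) ≡ i
toCode-fromCode k i = trans (funToFin-cong bits) (funToFin-finToFin {k} i)
  where
  bits : ∀ j → fromBool (lookup (fromCode {k} i) j) ≡ finToFun {n = k} i j
  bits j = trans (cong fromBool (lookup∘tabulate _ j)) (strictlyInverseʳ (finToFun {n = k} i j))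

fromCode-toCode : ∀ {k} (S : Subset k) → fromCode (toCode S) ≡ S
fromCode-toCode S = trans (tabulate-cong bits) (tabulate∘lookup S)
  where
  bits : ∀ j → toBool (finToFun (toCode S) j) ≡ lookup S j
  bits j = trans (cong toBool (finToFun-funToFin (fromBool ∘ lookup S) j))
                 (strictlyInverseˡ (lookup S j))

subsets-count : ∀ {m k} {f : Fin m → Subset k} {g : Subset k → Fin m} →
  Injective _≡_ _≡_ f → Injective _≡_ _≡_ g → m ≡ 2 ^ k
subsets-count {k = k} {f} {g} f-inj g-inj =
  cantor-schröder-bernstein {f = toCode ∘ f} {g = g ∘ fromCode {k}}
    (f-inj ∘ retraction⇒injective fromCode fromCode-toCode)
    (retraction⇒injective toCode (toCode-fromCode k) ∘ g-inj)

edge : (H : Hypergraph) → Fin (List.length (edges H)) → Subset (n H)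
edge H = List.lookup (edges H)

record IndependentFamily (H : Hypergraph) (k : ℕ) : Set where
  field
    index    : Fin k → Fin (List.length (edges H))
    witness  : Subset k → Fin (n H)
    realises : ∀ S j → lookup (edge H (index j)) (witness S) ≡ lookup S j

shrink : ∀ {H k r} → IndependentFamily H (k + r) → IndependentFamily H k
shrink {r = r} fam = record
  { index    = λ j → index (j ↑ˡ r)
  ; witness  = λ S → witness (S ++ replicate r outside)
  ; realises = λ S j → trans (realises _ (j ↑ˡ r)) (lookup-++ˡ S _ j)
  }
  where open IndependentFamily fam

module TestCoverOf {H : Hypergraph} {k : ℕ} (fam : IndependentFamily H k) where
  open IndependentFamily fam

  trace : Fin (n H) → Subset k
  trace w = tabulate (λ j → lookup (edge H (index j)) w)

  trace-witness : ∀ S → trace (witness S) ≡ S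
  trace-witness S = trans (tabulate-cong (realises S)) (tabulate∘lookup S)

  Canonical : Fin (n H) → Set
  Canonical w = witness (trace w) ≡ w × Nonempty (trace w)

  canonical? : Decidable Canonical
  canonical? w = (witness (trace w) ≟ᶠ w) ×-dec nonempty? (trace w)

  witness-canonical : ∀ S → Nonempty S → Canonical (witness S)
  witness-canonical S S≠∅ =
    cong witness (trace-witness S) , subst Nonempty (sym (trace-witness S)) S≠∅

  V : Subset (n H)
  V = select canonical?

  code : Fin (size V) → Subset k
  code u = trace (embed V u)

  code-nonempty : ∀ u → Nonempty (code u)
  code-nonempty u = proj₂ (select-sound canonical? (embed-∈ V u))

  code-≢⊥ : ∀ u → code u ≢ ⊥
  code-≢⊥ u code≡⊥ = let j , j∈ = code-nonempty u in ∉⊥ (subst (j ∈_) code≡⊥ j∈)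

  -- A canonical vertex is the witness of its own code.
  code-injective : Injective _≡_ _≡_ code
  code-injective {u} {v} codes≡ = embed-injective V (begin
    embed V u               ≡⟨ sym (proj₁ (select-sound canonical? (embed-∈ V u))) ⟩
    witness (code u)        ≡⟨ cong witness codes≡ ⟩
    witness (code v)        ≡⟨ proj₁ (select-sound canonical? (embed-∈ V v)) ⟩
    embed V v               ∎)
    where open ≡-Reasoning

  vertexWith : ∀ S → Nonempty S → Fin (size V)
  vertexWith S S≠∅ = unembed V (select-complete canonical? (witness-canonical S S≠∅))

  code-vertexWith : ∀ S S≠∅ → code (vertexWith S S≠∅) ≡ S
  code-vertexWith S S≠∅ =
    trans (cong trace (embed-unembed V _)) (trace-witness S)

  test : Fin k → Subset (size V)
  test j = restrict V (edge H (index j))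

  test-code : ∀ j u → lookup (test j) u ≡ lookup (code u) j
  test-code j u = trans (restrict-lookup V _ u) (sym (lookup∘tabulate _ j))

  ∈-test⁺ : ∀ {j u} → j ∈ code u → u ∈ test j
  ∈-test⁺ {j} {u} = ∈-transport (sym (test-code j u))

  ∈-test⁻ : ∀ {j u} → u ∈ test j → j ∈ code u
  ∈-test⁻ {j} {u} = ∈-transport (test-code j u)

  -- The vertex with code {j} lies in test j but in no other test.
  test-injective : Injective _≡_ _≡_ test
  test-injective {j} {j′} tests≡ = sym (x∈⁅y⁆⇒x≡y j (subst (j′ ∈_) code≡⁅j⁆ j′∈code))
    where
    u = vertexWith ⁅ j ⁆ (j , x∈⁅x⁆ j)
    code≡⁅j⁆ = code-vertexWith ⁅ j ⁆ (j , x∈⁅x⁆ j)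
    u∈test : u ∈ test j
    u∈test = ∈-test⁺ (subst (j ∈_) (sym code≡⁅j⁆) (x∈⁅x⁆ j))
    j′∈code : j′ ∈ code u
    j′∈code = ∈-test⁻ (subst (u ∈_) tests≡ u∈test)

  test-separates : ∀ u v → u ≢ v →
    ∃ λ j → (u ∈ test j × v ∉ test j) ⊎ (v ∈ test j × u ∉ test j)
  test-separates u v u≢v =
    let j , s = distinct⇒separated (code u) (code v) (u≢v ∘ code-injective)
    in  j , Sum.map separating separating s
    where
    separating : ∀ {j x y} → j ∈ code x ∖ code y → x ∈ test j × y ∉ test j
    separating (j∈x , j∉y) = ∈-test⁺ j∈x , j∉y ∘ ∈-test⁻

  testCover : TestCover (project H V) k
  testCover = test , test-injective
            , (λ j → ∈-map⁺ (restrict V) (∈-lookup (index j)))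
            , (λ u → let j , j∈ = code-nonempty u in j , ∈-test⁺ j∈)
            , test-separates

  -- Counting V: adjoining the empty pattern, codes biject with Subset k.
  codeOrEmpty : Fin (suc (size V)) → Subset k
  codeOrEmpty zero    = ⊥
  codeOrEmpty (suc u) = code u

  codeOrEmpty-injective : Injective _≡_ _≡_ codeOrEmpty
  codeOrEmpty-injective {zero}  {zero}  _ = refl
  codeOrEmpty-injective {zero}  {suc v} e = ⊥-elim (code-≢⊥ v (sym e))
  codeOrEmpty-injective {suc u} {zero}  e = ⊥-elim (code-≢⊥ u e)
  codeOrEmpty-injective {suc u} {suc v} e = cong suc (code-injective e)

  vertexOrZero : Subset k → Fin (suc (size V))
  vertexOrZero S with nonempty? S
  ... | yes S≠∅ = suc (vertexWith S S≠∅)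
  ... | no  _   = zero

  codeOrEmpty-vertexOrZero : ∀ S → codeOrEmpty (vertexOrZero S) ≡ S
  codeOrEmpty-vertexOrZero S with nonempty? S
  ... | yes S≠∅ = code-vertexWith S S≠∅
  ... | no  S=∅ = sym (Empty-unique S=∅)

  size-V : size V ≡ 2 ^ k ∸ 1
  size-V = cong (_∸ 1) (subsets-count codeOrEmpty-injective
    (retraction⇒injective {s = vertexOrZero} codeOrEmpty codeOrEmpty-vertexOrZero))

independent⇒testCover : ∀ {H k} → IndependentFamily H k →
  ∃ λ V → (size V ≡ 2 ^ k ∸ 1) × TestCover (project H V) k
independent⇒testCover fam = V , size-V , testCover
  where open TestCoverOf fam

incidence : (H : Hypergraph) → Fin (n H) → Subset (List.length (edges H))
incidence H v = tabulate (λ i → lookup (edge H i) v)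

-- The hyperedges of H indexed by a set shattered in the dual hypergraph form
-- an independent family: pattern S is realised by the vertex whose dual
-- hyperedge meets X in S.
shattered⇒independent : ∀ {H} {X : Subset (List.length (edges H))} →
  Shattered (dual H) X → IndependentFamily H (size X)
shattered⇒independent {H} {X} shattered = record
  { index    = embed X
  ; witness  = proj₁ ∘ realiser
  ; realises = realises
  }
  where
  realiser : ∀ S → ∃ λ v → incidence H v ∩ X ≡ lift X S
  realiser S with shattered (lift X S) (lift-⊆ X S)
  ... | e , e∈dual , e∩X≡ with ∈-tabulate⁻ e∈dual
  ...   | v , refl = v , e∩X≡

  realises : ∀ S u → lookup (edge H (embed X u)) (proj₁ (realiser S)) ≡ lookup S u
  realises S u = begin
    lookup (edge H (embed X u)) v          ≡⟨ lookup∘tabulate _ (embed X u) ⟨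
    lookup (incidence H v) (embed X u)     ≡⟨ restrict-lookup X _ u ⟨
    lookup (restrict X (incidence H v)) u  ≡⟨ cong (λ Y → lookup Y u)
                                                (∩≡lift⇒restrict≡ X _ (proj₂ (realiser S))) ⟩
    lookup S u                             ∎
    where
    open ≡-Reasoning
    v = proj₁ (realiser S)

dualVC⇒independent : ∀ {H k} → VC≥ (dual H) k → IndependentFamily H k
dualVC⇒independent {H} {k} (X , shattered , ∣X∣≥k) =
  let r , k+r≡size = m≤n⇒∃[o]m+o≡n (subst (k ≤_) (sym (size≡∣∣ X)) ∣X∣≥k)
  in  shrink (subst (IndependentFamily H) (sym k+r≡size) (shattered⇒independent shattered))

proposition2 : (C : Hypergraph → Set) → ProjectionStable C → UnboundedDualVC C →
    ∀ (k : ℕ) → ∃ λ H → C H × (n H ≡ 2 ^ k ∸ 1) × TestCover H k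
proposition2 C stable unbounded k =
  let H , H∈C , dualVC≥k   = unbounded k
      V , size≡ , testCover = independent⇒testCover (dualVC⇒independent dualVC≥k)
  in  project H V , stable H H∈C V , size≡ , testCover
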